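{- Let $d\ge 1$ be an integer, and let $(B_\ell)$, $(C_\ell)$, $(D_\ell)$ be sequences indexed by even integers $\ell\ge 6$ satisfying, for every even $\ell\ge 8$, $$B_\ell=(d-1)D_{\ell-2}+d\,C_{\ell-2},\quad C_\ell=(d-1)D_{\ell-2}+d\,B_{\ell-2},\quad D_\ell=(d^2-3d+3)D_{\ell-2}+(d-1)^2C_{\ell-2}+(d-1)^2B_{\ell-2},$$ with initial values $B_6=(d+1)d(d-1)^3$, $C_6=(d+1)d(d^3-2d^2+3d-1)$, $D_6=(d+1)d(d-1)^2(d^2-2d+3)$. Then for every even $\ell\ge 6$, $$B_\ell=d(d^2-d+1)^{\ell/2-1}+\tfrac12(-1)^{\ell/2-1}d(d-1)(d-2)^{\ell/2-1}+\tfrac12(-1)^{\ell/2}(d+1)d^{\ell/2},$$ $$C_\ell=\tfrac12(-1)^{\ell/2-1}(d-1)d(d-2)^{\ell/2-1}+d(d^2-d+1)^{\ell/2-1}-\tfrac12(-1)^{\ell/2}d^{\ell/2}(d+1),$$ $$D_\ell=(d-1)d\left((d^2-d+1)^{\ell/2-1}-(-1)^{\ell/2-1}(d-2)^{\ell/2-1}\right).$$ -}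

module Defs where

open import Data.Nat using (ℕ; zero; suc)
open import Data.Rational using (ℚ; 1ℚ; _*_)

_^ℚ_ : ℚ → ℕ → ℚ
q ^ℚ zero  = 1ℚ
q ^ℚ suc n = q * (q ^ℚ n)

infixr 8 _^ℚ_

-- Read at even ℓ = 2k, the recurrence is the iteration of a linear map on ℚ³ whose
-- eigenvalues are d² − d + 1, −(d − 2) and −d; the claimed formulas are the corresponding
-- combination of eigenvectors. So it suffices to check that they satisfy the recurrence,
-- a polynomial identity once the powers of the eigenvalues are taken as indeterminates,
-- and that they take the prescribed values at ℓ = 6; a first-order recurrence then
-- determines everything from ℓ = 6 on.
module Submission where

open import Defs
open import Data.Nat using (ℕ; suc; _≤_; _≤′_; ≤′-refl; ≤′-step; _∸_; _/_; s≤s; z≤n)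
open import Data.Nat using () renaming (_*_ to _*ℕ_)
open import Data.Nat.Properties using (≤⇒≤′; ≤′⇒≤; ≤-trans; *-cancelʳ-≤; *-monoˡ-≤)
open import Data.Nat.Divisibility using (_∣_; divides)
open import Data.Nat.DivMod using (m*n/n≡m)
open import Data.Rational using (ℚ; _+_; _*_; _-_; -_; ½; 1ℚ; 0ℚ)
open import Data.Rational using () renaming (_/_ to _÷_)
open import Data.Rational.Properties using (_≟_; +-*-commutativeRing; *-identityʳ)
open import Data.Integer using (+_)
open import Data.Product using (_×_; _,_)
open import Data.List using (List; []; _∷_)
open import Function using (_∘_)
open import Level using (0ℓ)
open import Relation.Nullary.Decidable using (dec⇒maybe)
open import Relation.Binary.PropositionalEquality
open import Tactic.RingSolver using (solve)
open import Tactic.RingSolver.Core.AlmostCommutativeRing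
  using (AlmostCommutativeRing; fromCommutativeRing)

recurrence-unique : ∀ {a} {A : Set a} (f : A → A) {u v : ℕ → A} {k₀ : ℕ} →
  (∀ {k} → k₀ ≤ k → u (suc k) ≡ f (u k)) →
  (∀ {k} → k₀ ≤ k → v (suc k) ≡ f (v k)) →
  u k₀ ≡ v k₀ → ∀ {k} → k₀ ≤ k → u k ≡ v k
recurrence-unique f {u} {v} {k₀} u-step v-step u≡v = agree ∘ ≤⇒≤′
  where
  agree : ∀ {k} → k₀ ≤′ k → u k ≡ v k
  agree ≤′-refl = u≡v
  agree {suc k} (≤′-step k₀≤′k) = begin
    u (suc k)  ≡⟨ u-step (≤′⇒≤ k₀≤′k) ⟩
    f (u k)    ≡⟨ cong f (agree k₀≤′k) ⟩
    f (v k)    ≡⟨ v-step (≤′⇒≤ k₀≤′k) ⟨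
    v (suc k)  ∎
    where open ≡-Reasoning

ℚ-ring : AlmostCommutativeRing 0ℓ 0ℓ
ℚ-ring = fromCommutativeRing +-*-commutativeRing (λ q → dec⇒maybe (0ℚ ≟ q))

2ℚ 3ℚ : ℚ
2ℚ = + 2 ÷ 1
3ℚ = + 3 ÷ 1

^ℚ-2 : ∀ q → q ^ℚ 2 ≡ q * q
^ℚ-2 q = cong (q *_) (*-identityʳ q)

-- A data type rather than _×_: step then computes on a literal triple by substitution,
-- producing terms the ring solver can read.
data ℚ³ : Set where
  ⟨_,_,_⟩ : ℚ → ℚ → ℚ → ℚ³

module _ {a b c a′ b′ c′ : ℚ} where

  ⟨⟩-cong : a ≡ a′ → b ≡ b′ → c ≡ c′ → ⟨ a , b , c ⟩ ≡ ⟨ a′ , b′ , c′ ⟩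
  ⟨⟩-cong refl refl refl = refl

  ⟨⟩-injective : ⟨ a , b , c ⟩ ≡ ⟨ a′ , b′ , c′ ⟩ → a ≡ a′ × b ≡ b′ × c ≡ c′
  ⟨⟩-injective refl = refl , refl , refl

step : ℚ → ℚ³ → ℚ³
step x ⟨ b , c , d ⟩ =
  ⟨ (x - 1ℚ) * d + x * c
  , (x - 1ℚ) * d + x * b
  , (x * x - 3ℚ * x + 3ℚ) * d + (x - 1ℚ) * (x - 1ℚ) * c + (x - 1ℚ) * (x - 1ℚ) * b ⟩

closedForm : ℚ → ℕ → ℚ³
closedForm x k =
  ⟨ x * (x * x - x + 1ℚ) ^ℚ (k ∸ 1)
      + ½ * (- 1ℚ) ^ℚ (k ∸ 1) * x * (x - 1ℚ) * (x - 2ℚ) ^ℚ (k ∸ 1)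
      + ½ * (- 1ℚ) ^ℚ k * (x + 1ℚ) * x ^ℚ k
  , ½ * (- 1ℚ) ^ℚ (k ∸ 1) * (x - 1ℚ) * x * (x - 2ℚ) ^ℚ (k ∸ 1)
      + x * (x * x - x + 1ℚ) ^ℚ (k ∸ 1)
      - ½ * (- 1ℚ) ^ℚ k * x ^ℚ k * (x + 1ℚ)
  , (x - 1ℚ) * x * ((x * x - x + 1ℚ) ^ℚ (k ∸ 1) - (- 1ℚ) ^ℚ (k ∸ 1) * (x - 2ℚ) ^ℚ (k ∸ 1)) ⟩

-- closedForm x (suc n) is closedFormIn x Λ M S P with Λ, M, S, P the n-th powers of
-- x² − x + 1, x − 2, −1 and x; the ring solver needs these powers as variables.
closedFormIn : (x Λ M S P : ℚ) → ℚ³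
closedFormIn x Λ M S P =
  ⟨ x * Λ + ½ * S * x * (x - 1ℚ) * M + ½ * (- 1ℚ * S) * (x + 1ℚ) * (x * P)
  , ½ * S * (x - 1ℚ) * x * M + x * Λ - ½ * (- 1ℚ * S) * (x * P) * (x + 1ℚ)
  , (x - 1ℚ) * x * (Λ - S * M) ⟩

closedFormIn-step : ∀ x Λ M S P →
  step x (closedFormIn x Λ M S P)
    ≡ closedFormIn x ((x * x - x + 1ℚ) * Λ) ((x - 2ℚ) * M) (- 1ℚ * S) (x * P)
closedFormIn-step x Λ M S P =
  ⟨⟩-cong (solve vars ℚ-ring) (solve vars ℚ-ring) (solve vars ℚ-ring)
  where
  vars : List ℚ
  vars = x ∷ Λ ∷ M ∷ S ∷ P ∷ []

closedForm-step : ∀ x {k} → 1 ≤ k → closedForm x (suc k) ≡ step x (closedForm x k)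
closedForm-step x {suc n} _ = sym (closedFormIn-step x
  ((x * x - x + 1ℚ) ^ℚ n) ((x - 2ℚ) ^ℚ n) ((- 1ℚ) ^ℚ n) (x ^ℚ n))

closedForm-1 : ∀ x → closedForm x 1 ≡ ⟨ 0ℚ , x * (x + 1ℚ) , 0ℚ ⟩
closedForm-1 x = closedFormIn-ones
  where
  closedFormIn-ones : closedFormIn x 1ℚ 1ℚ 1ℚ 1ℚ ≡ ⟨ 0ℚ , x * (x + 1ℚ) , 0ℚ ⟩
  closedFormIn-ones = ⟨⟩-cong (solve (x ∷ []) ℚ-ring) (solve (x ∷ []) ℚ-ring) (solve (x ∷ []) ℚ-ring)

initialValues : ℚ → ℚ³
initialValues x =
  ⟨ (x + 1ℚ) * x * (x - 1ℚ) ^ℚ 3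
  , (x + 1ℚ) * x * (x ^ℚ 3 - 2ℚ * x ^ℚ 2 + 3ℚ * x - 1ℚ)
  , (x + 1ℚ) * x * (x - 1ℚ) ^ℚ 2 * (x ^ℚ 2 - 2ℚ * x + 3ℚ) ⟩

-- The initial values at ℓ = 6 are two steps of the recurrence from the value
-- ⟨ 0 , d (d + 1) , 0 ⟩ the closed forms take at ℓ = 2.
closedForm-3 : ∀ x → closedForm x 3 ≡ initialValues x
closedForm-3 x = begin
  closedForm x 3                          ≡⟨ closedForm-step x {2} (s≤s z≤n) ⟩
  step x (closedForm x 2)                 ≡⟨ cong (step x) (closedForm-step x {1} (s≤s z≤n)) ⟩
  step x (step x (closedForm x 1))        ≡⟨ cong (step x ∘ step x) (closedForm-1 x) ⟩
  step x (step x ⟨ 0ℚ , x * (x + 1ℚ) , 0ℚ ⟩) ≡⟨ ⟨⟩-cong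
    -- initialValues x with its powers unfolded, so that the ring solver can read them
    {a′ = (x + 1ℚ) * x * ((x - 1ℚ) * ((x - 1ℚ) * ((x - 1ℚ) * 1ℚ)))}
    {b′ = (x + 1ℚ) * x * (x * (x * (x * 1ℚ)) - 2ℚ * (x * (x * 1ℚ)) + 3ℚ * x - 1ℚ)}
    {c′ = (x + 1ℚ) * x * ((x - 1ℚ) * ((x - 1ℚ) * 1ℚ)) * (x * (x * 1ℚ) - 2ℚ * x + 3ℚ)}
    (solve (x ∷ []) ℚ-ring) (solve (x ∷ []) ℚ-ring) (solve (x ∷ []) ℚ-ring) ⟩
  initialValues x                         ∎
  where open ≡-Reasoning

lemma16 : (d : ℕ) → 1 ≤ d →
    let dq = + d ÷ 1
        one = 1ℚ
        two = + 2 ÷ 1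
        three = + 3 ÷ 1
        m1 = - one
    in (B C D : ℕ → ℚ) →
    (∀ ℓ → 2 ∣ ℓ → 8 ≤ ℓ →
        B ℓ ≡ (dq - one) * D (ℓ ∸ 2) + dq * C (ℓ ∸ 2)) →
    (∀ ℓ → 2 ∣ ℓ → 8 ≤ ℓ →
        C ℓ ≡ (dq - one) * D (ℓ ∸ 2) + dq * B (ℓ ∸ 2)) →
    (∀ ℓ → 2 ∣ ℓ → 8 ≤ ℓ →
        D ℓ ≡ (dq * dq - three * dq + three) * D (ℓ ∸ 2)
              + (dq - one) ^ℚ 2 * C (ℓ ∸ 2) + (dq - one) ^ℚ 2 * B (ℓ ∸ 2)) →
    B 6 ≡ (dq + one) * dq * (dq - one) ^ℚ 3 →
    C 6 ≡ (dq + one) * dq * (dq ^ℚ 3 - two * dq ^ℚ 2 + three * dq - one) →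
    D 6 ≡ (dq + one) * dq * (dq - one) ^ℚ 2 * (dq ^ℚ 2 - two * dq + three) →
    ∀ ℓ → 2 ∣ ℓ → 6 ≤ ℓ →
      (B ℓ ≡ dq * (dq * dq - dq + one) ^ℚ (ℓ / 2 ∸ 1)
             + ½ * m1 ^ℚ (ℓ / 2 ∸ 1) * dq * (dq - one) * (dq - two) ^ℚ (ℓ / 2 ∸ 1)
             + ½ * m1 ^ℚ (ℓ / 2) * (dq + one) * dq ^ℚ (ℓ / 2))
      × (C ℓ ≡ ½ * m1 ^ℚ (ℓ / 2 ∸ 1) * (dq - one) * dq * (dq - two) ^ℚ (ℓ / 2 ∸ 1)
             + dq * (dq * dq - dq + one) ^ℚ (ℓ / 2 ∸ 1)
             - ½ * m1 ^ℚ (ℓ / 2) * dq ^ℚ (ℓ / 2) * (dq + one))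
      × (D ℓ ≡ (dq - one) * dq * ((dq * dq - dq + one) ^ℚ (ℓ / 2 ∸ 1)
             - m1 ^ℚ (ℓ / 2 ∸ 1) * (dq - two) ^ℚ (ℓ / 2 ∸ 1)))
lemma16 d _ B C D hB hC hD b₆ c₆ d₆ .(k *ℕ 2) (divides k refl) 6≤2k rewrite m*n/n≡m k 2 {{_}} =
  ⟨⟩-injective (recurrence-unique (step x) evenTerms-step
    (λ 3≤j → closedForm-step x (≤-trans (s≤s z≤n) 3≤j))
    evenTerms-3 (*-cancelʳ-≤ 3 k 2 6≤2k))
  where
  x : ℚ
  x = + d ÷ 1

  evenTerms : ℕ → ℚ³
  evenTerms j = ⟨ B (j *ℕ 2) , C (j *ℕ 2) , D (j *ℕ 2) ⟩

  evenTerms-3 : evenTerms 3 ≡ closedForm x 3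
  evenTerms-3 = trans (⟨⟩-cong b₆ c₆ d₆) (sym (closedForm-3 x))

  evenTerms-step : ∀ {j} → 3 ≤ j → evenTerms (suc j) ≡ step x (evenTerms j)
  evenTerms-step {j} 3≤j = ⟨⟩-cong (hB ℓ ℓ-even 8≤ℓ) (hC ℓ ℓ-even 8≤ℓ) (trans (hD ℓ ℓ-even 8≤ℓ)
    (cong (λ s → (x * x - 3ℚ * x + 3ℚ) * D (j *ℕ 2) + s * C (j *ℕ 2) + s * B (j *ℕ 2))
          (^ℚ-2 (x - 1ℚ))))
    where
    ℓ : ℕ
    ℓ = suc j *ℕ 2
    ℓ-even : 2 ∣ ℓ
    ℓ-even = divides (suc j) refl
    8≤ℓ : 8 ≤ ℓ
    8≤ℓ = *-monoˡ-≤ 2 (s≤s 3≤j)
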